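{- If $C$ is a basic strongly connected component in $\mathrm{BPA}^*_{01}$, then $\mathrm{Ext}_n(p)=\emptyset$ for all $p\in C$.
   Context: Fix a non-empty set $A$ of actions. $\mathrm{BPA}^*_{01}$ expressions are generated by $p ::= \mathbf{0} \mid \mathbf{1} \mid a \mid p\cdot p \mid p+p \mid p^*$ with $a\in A$ (equality is syntactic identity). The transition relation $p\xrightarrow{a}p'$ and termination predicate $p\downarrow$ are the least relations such that: $\mathbf{1}\downarrow$; $a\xrightarrow{a}\mathbf{1}$; if $p\xrightarrow{a}p'$ then $p+q\xrightarrow{a}p'$ and $q+p\xrightarrow{a}p'$; if $p\downarrow$ then $(p+q)\downarrow$ and $(q+p)\downarrow$; if $p\xrightarrow{a}p'$ then $p\cdot q\xrightarrow{a}p'\cdot q$; if $p\downarrow$ and $q\xrightarrow{a}q'$ then $p\cdot q\xrightarrow{a}q'$; if $p\downarrow$ and $q\downarrow$ then $(p\cdot q)\downarrow$; if $p\xrightarrow{a}p'$ then $p^*\xrightarrow{a}p'\cdot p^*$; $p^*\downarrow$. Write $p\to q$ if $p\xrightarrow{a}q$ for some $a$, and $\to^*$ for its reflexive-transitive closure. A strongly connected component is a maximal set $C$ of expressions with $s\to^* s'$ for all $s,s'\in C$; it is trivial if $C=\{s\}$ and not $s\to s$, non-trivial otherwise. A non-trivial strongly connected component $C=\{p_1,\dots,p_n\}$ is basic if there exist expressions $p_1',\dots,p_n'$ and $q$ such that $p_i=p_i'\cdot q^*$ for $1\le i\le n$ and $\{p_1',\dots,p_n'\}$ is not a strongly connected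 component. An expression $s$ is normed if $s\to^* s'$ for some $s'$ with $s'\downarrow$. For $s$ in a strongly connected component $C$, $\mathrm{Ext}_n(s)=\{(a,s')\mid s\xrightarrow{a}s',\ s'\notin C,\ s'\text{ normed}\}$. -}

module Defs where

open import Data.Product using (Σ; ∃; _×_; _,_)
open import Relation.Nullary using (¬_)
open import Relation.Binary.PropositionalEquality using (_≡_)

-- BPA*_01 expressions over an action type A (equality = syntactic identity, i.e. _≡_)
data Exp (A : Set) : Set where
  𝟘   : Exp A
  𝟙   : Exp A
  act : A → Exp A
  _·_ : Exp A → Exp A → Exp A
  _⊕_ : Exp A → Exp A → Exp A
  _⋆  : Exp A → Exp A

infixl 7 _·_
infixl 6 _⊕_
infix 8 _⋆

module _ {A : Set} where

  data _↓ : Exp A → Set where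
    𝟙↓  : 𝟙 ↓
    ⊕ˡ↓ : ∀ {p q} → p ↓ → (p ⊕ q) ↓
    ⊕ʳ↓ : ∀ {p q} → p ↓ → (q ⊕ p) ↓
    ·↓  : ∀ {p q} → p ↓ → q ↓ → (p · q) ↓
    ⋆↓  : ∀ {p} → (p ⋆) ↓

  data _─[_]→_ : Exp A → A → Exp A → Set where
    actT : ∀ {a} → act a ─[ a ]→ 𝟙
    ⊕ˡT  : ∀ {p q a p'} → p ─[ a ]→ p' → (p ⊕ q) ─[ a ]→ p'
    ⊕ʳT  : ∀ {p q a p'} → p ─[ a ]→ p' → (q ⊕ p) ─[ a ]→ p'
    ·ˡT  : ∀ {p q a p'} → p ─[ a ]→ p' → (p · q) ─[ a ]→ (p' · q)
    ·ʳT  : ∀ {p q a q'} → p ↓ → q ─[ a ]→ q' → (p · q) ─[ a ]→ q'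
    ⋆T   : ∀ {p a p'} → p ─[ a ]→ p' → (p ⋆) ─[ a ]→ (p' · (p ⋆))

  Step : Exp A → Exp A → Set
  Step p q = ∃ λ a → p ─[ a ]→ q

  data _→*_ : Exp A → Exp A → Set where
    ε   : ∀ {p} → p →* p
    _◅_ : ∀ {p q r} → Step p q → q →* r → p →* r

  ExpSet : Set₁
  ExpSet = Exp A → Set

  MutuallyReachable : ExpSet → Set
  MutuallyReachable C = ∀ s s' → C s → C s' → s →* s'

  IsSCC : ExpSet → Set₁
  IsSCC C = MutuallyReachable C
          × (∀ (D : ExpSet) → (∀ s → C s → D s) → MutuallyReachable D → ∀ s → D s → C s)

  Trivial : ExpSet → Set
  Trivial C = Σ (Exp A) λ s → C s × (∀ t → C t → t ≡ s) × ¬ Step s s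

  NonTrivialSCC : ExpSet → Set₁
  NonTrivialSCC C = IsSCC C × ¬ Trivial C

  Basic : ExpSet → Set₁
  Basic C = NonTrivialSCC C
          × Σ (Exp A) λ q →
              (∀ p → C p → ∃ λ p' → p ≡ p' · (q ⋆))
            × ¬ IsSCC (λ p' → C (p' · (q ⋆)))

  Normed : Exp A → Set
  Normed s = ∃ λ s' → s →* s' × s' ↓

  Extn : ExpSet → Exp A → A → Exp A → Set
  Extn C s a s' = s ─[ a ]→ s' × ¬ C s' × Normed s'

-- Write the component as C = {pᵢ'·q*}. A move leaving C towards a normed s' happens inside
-- the pᵢ' (the suffix q* stays), so s' = x·q* reaches y·q* with y↓ and can hence restart
-- the loop q*. If some path inside C restarted the loop, s' would reach back into C and be
-- absorbed by it. So paths inside C never restart q*: they are lifts of paths between the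
-- pᵢ', whence {pᵢ'} is mutually reachable and (by maximality of C) maximal, i.e. an SCC,
-- contradicting basicness.
module Submission where

open import Defs
open import Relation.Nullary using (¬_)
open import Data.Product using (∃; _×_; _,_)
open import Data.Sum using (_⊎_; inj₁; inj₂)
open import Relation.Binary.PropositionalEquality using (_≡_; refl)

module _ {A : Set} where

  infixr 5 _◅◅_

  _◅◅_ : {p q r : Exp A} → p →* q → q →* r → p →* r
  ε ◅◅ ys = ys
  (s ◅ xs) ◅◅ ys = s ◅ (xs ◅◅ ys)

  ·ˡ-→* : {x y r : Exp A} → x →* y → (x · r) →* (y · r)
  ·ˡ-→* ε = ε
  ·ˡ-→* ((a , s) ◅ xs) = (a , ·ˡT s) ◅ ·ˡ-→* xs

  ·↓ˡ : {p q : Exp A} → (p · q) ↓ → p ↓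
  ·↓ˡ (·↓ p↓ _) = p↓

  →*-·⋆-shape : {x t q : Exp A} → (x · q ⋆) →* t → ∃ λ y → t ≡ y · q ⋆
  →*-·⋆-shape ε = _ , refl
  →*-·⋆-shape ((_ , ·ˡT _) ◅ xs) = →*-·⋆-shape xs
  →*-·⋆-shape ((_ , ·ʳT _ (⋆T _)) ◅ xs) = →*-·⋆-shape xs

  ·⋆-split : {x z q : Exp A} → (x · q ⋆) →* (z · q ⋆) →
             (x →* z) ⊎ (∃ λ r → Step q r × (r · q ⋆) →* (z · q ⋆))
  ·⋆-split ε = inj₁ ε
  ·⋆-split ((a , ·ˡT s) ◅ xs) with ·⋆-split xs
  ... | inj₁ π = inj₁ ((a , s) ◅ π)
  ... | inj₂ restart = inj₂ restart
  ·⋆-split ((a , ·ʳT _ (⋆T s)) ◅ xs) = inj₂ (_ , (a , s) , xs)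

  Normed-·⋆-restart : {x q r : Exp A} → Normed (x · q ⋆) → Step q r → (x · q ⋆) →* (r · q ⋆)
  Normed-·⋆-restart (t , x→t , t↓) (a , q→r) with →*-·⋆-shape x→t
  ... | y , refl = x→t ◅◅ ((a , ·ʳT (·↓ˡ t↓) (⋆T q→r)) ◅ ε)

  IsSCC-convex : {C : ExpSet {A}} {c c' u : Exp A} → IsSCC C →
                 C c → C c' → c →* u → u →* c' → C u
  IsSCC-convex {C} {c} {c'} {u} (reach , maximal) Cc Cc' c→u u→c' =
    maximal (λ v → C v ⊎ v ≡ u) (λ _ → inj₁) reach⁺ u (inj₂ refl)
    where
    reach⁺ : MutuallyReachable (λ v → C v ⊎ v ≡ u)
    reach⁺ v w (inj₁ Cv) (inj₁ Cw) = reach v w Cv Cw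
    reach⁺ v _ (inj₁ Cv) (inj₂ refl) = reach v c Cv Cc ◅◅ c→u
    reach⁺ _ w (inj₂ refl) (inj₁ Cw) = u→c' ◅◅ reach c' w Cc' Cw
    reach⁺ _ _ (inj₂ refl) (inj₂ refl) = ε

  ·-preimage-maximal : {C : ExpSet {A}} {r d : Exp A} → IsSCC C → C (d · r) →
                       ∀ (D : ExpSet) → (∀ s → C (s · r) → D s) → MutuallyReachable D →
                       ∀ s → D s → C (s · r)
  ·-preimage-maximal sccC Cdr D sub reachD s Ds =
    IsSCC-convex sccC Cdr Cdr (·ˡ-→* (reachD _ s Dd Ds)) (·ˡ-→* (reachD s _ Ds Dd))
    where Dd = sub _ Cdr

  ·⋆-preimage-reachable : {C : ExpSet {A}} {q : Exp A} → IsSCC C →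
                          (∀ r z → Step q r → (r · q ⋆) →* (z · q ⋆) → ¬ C (z · q ⋆)) →
                          MutuallyReachable (λ s → C (s · q ⋆))
  ·⋆-preimage-reachable (reach , _) noRestart s t Cs Ct with ·⋆-split (reach _ _ Cs Ct)
  ... | inj₁ s→t = s→t
  ... | inj₂ (r , q→r , r→t) with noRestart r t q→r r→t Ct
  ... | ()

lemma17 : (A : Set) → A → (C : Exp A → Set) → Basic C →
          ∀ p → C p → ∀ (a : A) (s' : Exp A) → ¬ Extn C p a s'
lemma17 A _ C ((sccC , _) , q , shape , notSCC) p Cp a s' (p→s' , s'∉C , s'-normed)
  with shape p Cp
... | p' , refl with →*-·⋆-shape ((a , p→s') ◅ ε)
... | x , refl = notSCC (preimage-reachable , ·-preimage-maximal sccC Cp)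
  where
  noRestart : ∀ r z → Step q r → (r · q ⋆) →* (z · q ⋆) → ¬ C (z · q ⋆)
  noRestart r z q→r r→z Cz =
    s'∉C (IsSCC-convex sccC Cp Cz ((a , p→s') ◅ ε)
                       (Normed-·⋆-restart s'-normed q→r ◅◅ r→z))

  preimage-reachable : MutuallyReachable (λ s → C (s · q ⋆))
  preimage-reachable = ·⋆-preimage-reachable sccC noRestart
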